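{- There exists a constant $c$ such that every unit interval graph $G$ satisfies $$\frac{\chi(G)}{3}\le \chi_1(G)\le \frac{\chi(G)}{3}+c.$$
   Context: All graphs are finite and simple. A 1-selection of a graph $G=(V,E)$ is a map $f$ assigning to each vertex $v$ a set $f(v)$ of at most one edge incident with $v$. The 1-removed subgraph $G_f$ has vertex set $V$ and edge set $E\setminus\bigcup_{v\in V}f(v)$. The robust chromatic number is $\chi_1(G)=\min_f\chi(G_f)$ over all 1-selections $f$. A unit interval graph is a graph whose vertices $v_1,\dots,v_n$ can be labelled by reals $r_1,\dots,r_n$ such that $v_i$ and $v_j$ ($i\neq j$) are adjacent iff $|r_i-r_j|<1$.
   Formalization: The labels $r_1,\dots,r_n$ defining a unit interval graph are rationals rather than reals. -}

module Defs where

open import Data.Nat using (ℕ; _≤_)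
open import Data.Fin using (Fin)
open import Data.Maybe using (Maybe; just)
open import Data.Product using (Σ; ∃; _×_; _,_)
open import Data.Empty using (⊥)
open import Relation.Nullary using (¬_)
open import Relation.Binary.PropositionalEquality using (_≡_; _≢_)
open import Data.Rational using (ℚ; ∣_∣; _-_; _<_; 1ℚ)

record Graph : Set₁ where
  field
    n     : ℕ
    Adj   : Fin n → Fin n → Set
    sym   : ∀ {u v} → Adj u v → Adj v u
    irrefl : ∀ {v} → ¬ Adj v v
open Graph public

Colorable : Graph → ℕ → Set
Colorable G k = Σ (Fin (n G) → Fin k) λ c → ∀ u v → Adj G u v → c u ≢ c v

IsChromaticNumber : Graph → ℕ → Set
IsChromaticNumber G k = Colorable G k × (∀ m → Colorable G m → k ≤ m)

-- A 1-selection: each vertex v selects at most one edge incident with v,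
-- encoded by the other endpoint (nothing = empty selection).
OneSelection : Graph → Set
OneSelection G = Σ (Fin (n G) → Maybe (Fin (n G))) λ f → ∀ v w → f v ≡ just w → Adj G v w

removed : (G : Graph) → OneSelection G → Graph
removed G (f , _) = record
  { n = n G
  ; Adj = λ u v → Adj G u v × ¬ (f u ≡ just v) × ¬ (f v ≡ just u)
  ; sym = λ { (a , p , q) → sym G a , q , p }
  ; irrefl = λ { (a , _ , _) → irrefl G a }
  }

IsRobustChromaticNumber : Graph → ℕ → Set
IsRobustChromaticNumber G k =
  (∃ λ f → Colorable (removed G f) k) × (∀ f m → Colorable (removed G f) m → k ≤ m)

IsUnitInterval : Graph → Set
IsUnitInterval G = Σ (Fin (n G) → ℚ) λ r →
  ∀ i j → i ≢ j → (Adj G i j → ∣ r i - r j ∣ < 1ℚ) × (∣ r i - r j ∣ < 1ℚ → Adj G i j)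

{-# OPTIONS --safe #-}
module Submission where

-- Sort the vertices by label. If the vertices at positions a < b are adjacent, then so are any two
-- vertices at positions between them, so b - a is smaller than any bound on the size of cliques.
-- Lower bound: if G_f is m-coloured, each colour class of a clique of G is a clique all of whose
-- edges f removes, which is impossible for a K₄; so cliques have at most 3m vertices, and
-- colouring by position modulo 3m is proper on G.
-- Upper bound: let f remove the edges inside each block of three consecutive positions. Colouring
-- the blocks by index modulo 2 + ⌊χ/3⌋ is proper on G_f, because two distinct blocks of the same
-- colour are more than χ positions apart while cliques have at most χ vertices.

open import Defs
open import Data.Nat using (ℕ; _≤_; _+_; _*_)
open import Data.Product using (∃; _×_)

open import Data.Nat.Base using (zero; suc; _<_; _∸_; _/_; _%_; NonZero; z≤n; s≤s; s≤s⁻¹; z<s)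
open import Data.Nat.Properties
open import Data.Nat.DivMod using (m≡m%n+[m/n]*n; m%n<n; m/n*n≤m; /-monoˡ-≤; m/n≡1+[m∸n]/n; _mod_)
open import Data.Nat.Tactic.RingSolver using (solve-∀)
open import Data.Fin.Base using (Fin; toℕ; fromℕ<)
open import Data.Fin.Properties using (toℕ-fromℕ<; toℕ-injective; toℕ<n; ¬Fin0) renaming (_≟_ to _≟ᶠ_)
open import Data.Rational.Base as ℚ using (ℚ; ∣_∣; -_; 1ℚ; 0ℚ)
import Data.Rational.Properties as ℚₚ
open import Algebra.Properties.Group ℚₚ.+-0-group using (⁻¹-anti-homo-//)
open import Data.Maybe.Base using (Maybe; just; nothing)
open import Data.Maybe.Properties using (just-injective) renaming (≡-dec to ≡-decᵐ)
open import Data.Product.Base using (_,_; proj₁; proj₂)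
open import Data.Sum.Base as Sum using (_⊎_; inj₁; inj₂)
open import Data.Empty using (⊥; ⊥-elim)
open import Data.List.Base using (List; []; _∷_; length; lookup; filter; tabulate; allFin)
open import Data.List.Properties using (length-tabulate)
open import Data.List.Relation.Unary.All as All using (All; []; _∷_)
import Data.List.Relation.Unary.All.Properties as Allₚ
import Data.List.Relation.Unary.AllPairs.Properties as AllPairs
open import Data.List.Relation.Unary.AllPairs using (AllPairs; []; _∷_)
open import Data.List.Relation.Unary.Any using (index)
open import Data.List.Relation.Unary.Any.Properties using (lookup-index)
open import Data.List.Relation.Unary.Unique.Propositional using (Unique)
open import Data.List.Relation.Unary.Unique.Propositional.Properties using (allFin⁺)
open import Data.List.Membership.Propositional using (_∈_)
open import Data.List.Membership.Propositional.Properties using (∈-allFin; ∈-lookup)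
open import Data.List.Relation.Binary.Permutation.Propositional using (_↭_; ↭-sym; ↭⇒↭ₛ)
open import Data.List.Relation.Binary.Permutation.Propositional.Properties using (∈-resp-↭)
import Data.List.Relation.Binary.Permutation.Setoid.Properties as Permutationₛ
open import Data.List.Relation.Ternary.Interleaving.Properties using (interleave-length)
import Data.List.Relation.Ternary.Interleaving.Propositional.Properties as Interleaving
open import Data.List.Relation.Unary.Sorted.TotalOrder.Properties using (lookup-mono-≤)
import Data.List.Sort as Sort
open import Relation.Binary.Bundles using (DecTotalOrder)
import Relation.Binary.Construct.On as On
open import Relation.Binary.Definitions using (tri<; tri≈; tri>)
open import Relation.Binary.PropositionalEquality using (_≡_; _≢_; refl; trans; cong; subst; subst₂; setoid; module ≡-Reasoning)
import Relation.Binary.PropositionalEquality as ≡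
open import Relation.Nullary using (¬_; Dec; yes; no; ¬?)
open import Relation.Unary using (Decidable)
open import Function.Base using (_∘_)

∣x-y∣≡y-x : ∀ {x y} → x ℚ.≤ y → ∣ x ℚ.- y ∣ ≡ y ℚ.- x
∣x-y∣≡y-x {x} {y} x≤y = begin
  ∣ x ℚ.- y ∣       ≡⟨ ≡.sym (ℚₚ.∣-p∣≡∣p∣ (x ℚ.- y)) ⟩
  ∣ - (x ℚ.- y) ∣   ≡⟨ cong ∣_∣ (⁻¹-anti-homo-// x y) ⟩
  ∣ y ℚ.- x ∣       ≡⟨ ℚₚ.0≤p⇒∣p∣≡p 0≤y-x ⟩
  y ℚ.- x           ∎
  where
  open ≡-Reasoning
  0≤y-x : 0ℚ ℚ.≤ y ℚ.- x
  0≤y-x = subst (ℚ._≤ y ℚ.- x) (ℚₚ.+-inverseʳ x) (ℚₚ.+-monoˡ-≤ (- x) x≤y)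

∣x-y∣≤∣a-b∣ : ∀ {a x y b} → a ℚ.≤ x → x ℚ.≤ y → y ℚ.≤ b → ∣ x ℚ.- y ∣ ℚ.≤ ∣ a ℚ.- b ∣
∣x-y∣≤∣a-b∣ a≤x x≤y y≤b =
  subst₂ ℚ._≤_ (≡.sym (∣x-y∣≡y-x x≤y)) (≡.sym (∣x-y∣≡y-x (ℚₚ.≤-trans a≤x (ℚₚ.≤-trans x≤y y≤b))))
    (ℚₚ.+-mono-≤ y≤b (ℚₚ.neg-antimono-≤ a≤x))

m%n≡o%n∧m<o⇒m+n≤o : ∀ {m o} n .{{_ : NonZero n}} → m % n ≡ o % n → m < o → m + n ≤ o
m%n≡o%n∧m<o⇒m+n≤o {m} {o} n m%n≡o%n m<o = begin
  m + n                       ≡⟨ cong (_+ n) (m≡m%n+[m/n]*n m n) ⟩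
  m % n + m / n * n + n       ≡⟨ +-assoc (m % n) _ n ⟩
  m % n + (m / n * n + n)     ≡⟨ cong (m % n +_) (+-comm (m / n * n) n) ⟩
  m % n + suc (m / n) * n     ≤⟨ +-mono-≤ (≤-reflexive m%n≡o%n) (*-monoˡ-≤ n m/n<o/n) ⟩
  o % n + o / n * n           ≡⟨ ≡.sym (m≡m%n+[m/n]*n o n) ⟩
  o                           ∎
  where
  open ≤-Reasoning
  m/n<o/n : m / n < o / n
  m/n<o/n with m / n <? o / n
  ... | yes lt = lt
  ... | no ≮ = ⊥-elim (<⇒≱ m<o (begin
    o                   ≡⟨ m≡m%n+[m/n]*n o n ⟩
    o % n + o / n * n   ≤⟨ +-mono-≤ (≤-reflexive (≡.sym m%n≡o%n)) (*-monoˡ-≤ n (≮⇒≥ ≮)) ⟩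
    m % n + m / n * n   ≡⟨ ≡.sym (m≡m%n+[m/n]*n m n) ⟩
    m                   ∎))

m≤2+m/3*3 : ∀ m → m ≤ 2 + m / 3 * 3
m≤2+m/3*3 m = subst (_≤ 2 + m / 3 * 3) (≡.sym (m≡m%n+[m/n]*n m 3))
  (+-monoˡ-≤ (m / 3 * 3) (s≤s⁻¹ (m%n<n m 3)))

mod≡∧<⇒+≤ : ∀ {m o} n .{{_ : NonZero n}} → m mod n ≡ o mod n → m < o → m + n ≤ o
mod≡∧<⇒+≤ n same =
  m%n≡o%n∧m<o⇒m+n≤o n (subst₂ _≡_ (toℕ-fromℕ< _) (toℕ-fromℕ< _) (cong toℕ same))

[3+m]/3≡1+m/3 : ∀ m → (3 + m) / 3 ≡ suc (m / 3)
[3+m]/3≡1+m/3 m = m/n≡1+[m∸n]/n {3 + m} {3} (s≤s (s≤s (s≤s z≤n)))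

partner : ℕ → ℕ
partner 0 = 1
partner 1 = 2
partner 2 = 0
partner (suc (suc (suc p))) = 3 + partner p

same-block⇒partners : ∀ {i j} → i < j → i / 3 ≡ j / 3 → partner i ≡ j ⊎ partner j ≡ i
same-block⇒partners {0} {1} _ _ = inj₁ refl
same-block⇒partners {0} {2} _ _ = inj₂ refl
same-block⇒partners {1} {2} _ _ = inj₁ refl
same-block⇒partners {suc (suc (suc i))} {suc (suc (suc j))} i<j eq =
  Sum.map (cong (3 +_)) (cong (3 +_))
    (same-block⇒partners (s≤s⁻¹ (s≤s⁻¹ (s≤s⁻¹ i<j)))
      (suc-injective (trans (≡.sym ([3+m]/3≡1+m/3 i)) (trans eq ([3+m]/3≡1+m/3 j)))))
same-block⇒partners {0} {suc (suc (suc j))} _ eq = ⊥-elim (0≢1+n (trans eq ([3+m]/3≡1+m/3 j)))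
same-block⇒partners {1} {suc (suc (suc j))} _ eq = ⊥-elim (0≢1+n (trans eq ([3+m]/3≡1+m/3 j)))
same-block⇒partners {2} {suc (suc (suc j))} _ eq = ⊥-elim (0≢1+n (trans eq ([3+m]/3≡1+m/3 j)))
same-block⇒partners {0} {0} () _
same-block⇒partners {1} {0} () _
same-block⇒partners {1} {1} (s≤s ()) _
same-block⇒partners {2} {0} () _
same-block⇒partners {2} {1} (s≤s ()) _
same-block⇒partners {2} {2} (s≤s (s≤s ())) _
same-block⇒partners {suc (suc (suc _))} {0} () _
same-block⇒partners {suc (suc (suc _))} {1} (s≤s ()) _
same-block⇒partners {suc (suc (suc _))} {2} (s≤s (s≤s ())) _

blocks-apart⇒far : ∀ i j k → i / 3 + (2 + k / 3) ≤ j / 3 → i + k < j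
blocks-apart⇒far i j k apart = begin-strict
  i + k                                   ≤⟨ +-mono-≤ (m≤2+m/3*3 i) (m≤2+m/3*3 k) ⟩
  (2 + i / 3 * 3) + (2 + k / 3 * 3)       <⟨ m<n+m _ {2} z<s ⟩
  2 + ((2 + i / 3 * 3) + (2 + k / 3 * 3)) ≡⟨ ≡.sym (expand (i / 3) (k / 3)) ⟩
  (i / 3 + (2 + k / 3)) * 3               ≤⟨ *-monoˡ-≤ 3 apart ⟩
  j / 3 * 3                               ≤⟨ m/n*n≤m j 3 ⟩
  j                                       ∎
  where
  open ≤-Reasoning
  expand : ∀ x y → (x + (2 + y)) * 3 ≡ 2 + ((2 + x * 3) + (2 + y * 3))
  expand = solve-∀

3*[2+m/3]≤m+3*2 : ∀ m → 3 * (2 + m / 3) ≤ m + 3 * 2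
3*[2+m/3]≤m+3*2 m = begin
  3 * (2 + m / 3)     ≡⟨ *-distribˡ-+ 3 2 (m / 3) ⟩
  3 * 2 + 3 * (m / 3) ≡⟨ +-comm (3 * 2) _ ⟩
  3 * (m / 3) + 3 * 2 ≤⟨ +-monoˡ-≤ (3 * 2) (subst (_≤ m) (*-comm (m / 3) 3) (m/n*n≤m m 3)) ⟩
  m + 3 * 2           ∎
  where open ≤-Reasoning

lookup-injective : ∀ {A : Set} {xs : List A} → Unique xs → ∀ {i j} → lookup xs i ≡ lookup xs j → i ≡ j
lookup-injective {xs = _ ∷ _} (_ ∷ _) {Fin.zero} {Fin.zero} _ = refl
lookup-injective {xs = _ ∷ _} (x∉xs ∷ _) {Fin.zero} {Fin.suc j} eq = ⊥-elim (All.lookup x∉xs (∈-lookup j) eq)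
lookup-injective {xs = _ ∷ _} (x∉xs ∷ _) {Fin.suc i} {Fin.zero} eq = ⊥-elim (All.lookup x∉xs (∈-lookup i) (≡.sym eq))
lookup-injective {xs = _ ∷ _} (_ ∷ xs!) {Fin.suc i} {Fin.suc j} eq = cong Fin.suc (lookup-injective xs! eq)

module _ {A : Set} {R : A → A → Set} {d : ℕ} (colour : A → ℕ)
         (monochromatic≤ : ∀ {t xs} → AllPairs R xs → All (λ x → colour x ≡ t) xs → length xs ≤ d)
         where

  length≤d*colours : ∀ t {xs} → AllPairs R xs → All (λ x → colour x < t) xs → length xs ≤ d * t
  length≤d*colours zero {[]} _ _ = z≤n
  length≤d*colours zero {_ ∷ _} _ (() ∷ _)
  length≤d*colours (suc t) {xs} R-xs <1+t = begin
    length xs                              ≡⟨ interleave-length (Interleaving.filter⁺ is-t? xs) ⟩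
    length (filter is-t? xs) + length rest ≤⟨ +-mono-≤ (monochromatic≤ (AllPairs.filter⁺ is-t? R-xs) (Allₚ.all-filter is-t? xs))
                                                       (length≤d*colours t (AllPairs.filter⁺ _ R-xs) rest<t) ⟩
    d + d * t                              ≡⟨ ≡.sym (*-suc d t) ⟩
    d * suc t                              ∎
    where
    open ≤-Reasoning
    is-t? : Decidable (λ x → colour x ≡ t)
    is-t? x = colour x ≟ t
    rest : List A
    rest = filter (¬? ∘ is-t?) xs
    rest<t : All (λ x → colour x < t) rest
    rest<t = All.zipWith (λ (<1+t , ≢t) → ≤∧≢⇒< (s≤s⁻¹ <1+t) ≢t)
               (Allₚ.filter⁺ _ <1+t , Allₚ.all-filter _ xs)

module _ {A : Set} (F : A → Maybe A) where

  Removes : A → A → Set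
  Removes x y = x ≢ y × (F x ≡ just y ⊎ F y ≡ just x)

  selects-two : ∀ {x y z} → F x ≡ just y → F x ≡ just z → y ≢ z → ⊥
  selects-two xy xz y≢z = y≢z (just-injective (trans (≡.sym xy) xz))

  selected-by-two : ∀ {a x y} → F x ≡ just a → F y ≡ just a → Removes x y → a ≢ x → a ≢ y → ⊥
  selected-by-two xa ya (_ , inj₁ xy) a≢x a≢y = selects-two xa xy a≢y
  selected-by-two xa ya (_ , inj₂ yx) a≢x a≢y = selects-two ya yx a≢x

  -- Six edges, but only four vertices to select them.
  ¬K₄-removed : ∀ {a b c d} → Removes a b → Removes a c → Removes a d →
                Removes b c → Removes b d → Removes c d → ⊥
  ¬K₄-removed (_ , inj₁ ab) (_ , inj₁ ac) _ (b≢c , _) _ _ = selects-two ab ac b≢c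
  ¬K₄-removed (_ , inj₁ ab) (_ , inj₂ ca) (_ , inj₁ ad) _ (b≢d , _) _ = selects-two ab ad b≢d
  ¬K₄-removed (_ , inj₁ ab) (a≢c , inj₂ ca) (a≢d , inj₂ da) _ _ cd = selected-by-two ca da cd a≢c a≢d
  ¬K₄-removed (a≢b , inj₂ ba) (a≢c , inj₂ ca) _ bc _ _ = selected-by-two ba ca bc a≢b a≢c
  ¬K₄-removed (_ , inj₂ ba) (_ , inj₁ ac) (_ , inj₁ ad) _ _ (c≢d , _) = selects-two ac ad c≢d
  ¬K₄-removed (a≢b , inj₂ ba) (_ , inj₁ ac) (a≢d , inj₂ da) _ bd _ = selected-by-two ba da bd a≢b a≢d


module _ (G : Graph) where

  adj⇒≢ : ∀ {u v} → Adj G u v → u ≢ v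
  adj⇒≢ {u} uv refl = irrefl G uv

  clique-length≤colours : ∀ {k} → Colorable G k → ∀ {xs} → AllPairs (Adj G) xs → length xs ≤ k
  clique-length≤colours {k} (c , proper) {xs} clique = subst (length xs ≤_) (*-identityˡ k)
    (length≤d*colours (toℕ ∘ c) monochromatic≤1 k clique (All.tabulate (λ _ → toℕ<n _)))
    where
    monochromatic≤1 : ∀ {t ys} → AllPairs (Adj G) ys → All (λ x → toℕ (c x) ≡ t) ys → length ys ≤ 1
    monochromatic≤1 {ys = []} _ _ = z≤n
    monochromatic≤1 {ys = _ ∷ []} _ _ = s≤s z≤n
    monochromatic≤1 {ys = x ∷ y ∷ _} ((xy ∷ _) ∷ _) (cx ∷ cy ∷ _) =
      ⊥-elim (proper x y xy (toℕ-injective (trans cx (≡.sym cy))))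

  clique-length≤3*colours-removed : ∀ f {m} → Colorable (removed G f) m →
                                    ∀ {xs} → AllPairs (Adj G) xs → length xs ≤ 3 * m
  clique-length≤3*colours-removed (F , F-adj) {m} (c , proper) clique =
    length≤d*colours (toℕ ∘ c) monochromatic≤3 m clique (All.tabulate (λ _ → toℕ<n _))
    where
    removes : ∀ {x y t} → Adj G x y → toℕ (c x) ≡ t → toℕ (c y) ≡ t → Removes F x y
    removes {x} {y} xy cx cy with ≡-decᵐ _≟ᶠ_ (F x) (just y) | ≡-decᵐ _≟ᶠ_ (F y) (just x)
    ... | yes Fxy | _       = adj⇒≢ xy , inj₁ Fxy
    ... | no _    | yes Fyx = adj⇒≢ xy , inj₂ Fyx
    ... | no ¬Fxy | no ¬Fyx = ⊥-elim (proper x y (xy , ¬Fxy , ¬Fyx) (toℕ-injective (trans cx (≡.sym cy))))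

    monochromatic≤3 : ∀ {t ys} → AllPairs (Adj G) ys → All (λ x → toℕ (c x) ≡ t) ys → length ys ≤ 3
    monochromatic≤3 {ys = []} _ _ = z≤n
    monochromatic≤3 {ys = _ ∷ []} _ _ = s≤s z≤n
    monochromatic≤3 {ys = _ ∷ _ ∷ []} _ _ = s≤s (s≤s z≤n)
    monochromatic≤3 {ys = _ ∷ _ ∷ _ ∷ []} _ _ = s≤s (s≤s (s≤s z≤n))
    monochromatic≤3 {ys = _ ∷ _ ∷ _ ∷ _ ∷ _}
      ((ab ∷ ac ∷ ad ∷ _) ∷ (bc ∷ bd ∷ _) ∷ (cd ∷ _) ∷ _) (a≡t ∷ b≡t ∷ c≡t ∷ d≡t ∷ _) =
      ⊥-elim (¬K₄-removed F (removes ab a≡t b≡t) (removes ac a≡t c≡t) (removes ad a≡t d≡t)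
                            (removes bc b≡t c≡t) (removes bd b≡t d≡t) (removes cd c≡t d≡t))

module UnitIntervalOrder (G : Graph) (unit-interval : IsUnitInterval G) where

  V : Set
  V = Fin (n G)

  r : V → ℚ
  r = proj₁ unit-interval

  adj⇒close : ∀ {u v} → Adj G u v → ∣ r u ℚ.- r v ∣ ℚ.< 1ℚ
  adj⇒close {u} {v} uv = proj₁ (proj₂ unit-interval u v (adj⇒≢ G uv)) uv

  close⇒adj : ∀ {u v} → u ≢ v → ∣ r u ℚ.- r v ∣ ℚ.< 1ℚ → Adj G u v
  close⇒adj {u} {v} u≢v = proj₂ (proj₂ unit-interval u v u≢v)

  adj? : ∀ u v → Dec (Adj G u v)
  adj? u v with u ≟ᶠ v | ∣ r u ℚ.- r v ∣ ℚₚ.<? 1ℚ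
  ... | yes u≡v | _        = no (λ uv → adj⇒≢ G uv u≡v)
  ... | no u≢v  | yes close = yes (close⇒adj u≢v close)
  ... | no _    | no far    = no (far ∘ adj⇒close)

  ≤-by-r : DecTotalOrder _ _ _
  ≤-by-r = On.decTotalOrder ℚₚ.≤-decTotalOrder r

  open Sort ≤-by-r using (sort; sort-↭; sort-↗)

  order : List V
  order = sort (allFin (n G))

  allFin↭order : allFin (n G) ↭ order
  allFin↭order = ↭-sym (sort-↭ (allFin (n G)))

  N : ℕ
  N = length order

  π : Fin N → V
  π = lookup order

  ∈order : ∀ v → v ∈ order
  ∈order v = ∈-resp-↭ allFin↭order (∈-allFin v)

  pos : V → Fin N
  pos v = index (∈order v)

  π∘pos : ∀ v → π (pos v) ≡ v
  π∘pos v = ≡.sym (lookup-index (∈order v))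

  π-injective : ∀ {x y} → π x ≡ π y → x ≡ y
  π-injective = lookup-injective
    (Permutationₛ.Unique-resp-↭ (setoid V) (↭⇒↭ₛ allFin↭order) (allFin⁺ (n G)))

  π-mono : ∀ {x y} → toℕ x ≤ toℕ y → r (π x) ℚ.≤ r (π y)
  π-mono = lookup-mono-≤ (DecTotalOrder.totalOrder ≤-by-r) (sort-↗ (allFin (n G)))

  -- Positions between two adjacent vertices carry labels between theirs.
  between-adjacent⇒adj : ∀ {u v x y} → toℕ (pos u) ≤ toℕ x → toℕ x < toℕ y → toℕ y ≤ toℕ (pos v) →
                          Adj G u v → Adj G (π x) (π y)
  between-adjacent⇒adj {u} {v} {x} {y} u≤x x<y y≤v uv =
    close⇒adj (λ πx≡πy → <-irrefl (cong toℕ (π-injective πx≡πy)) x<y)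
      (ℚₚ.≤-<-trans (∣x-y∣≤∣a-b∣ (subst (ℚ._≤ r (π x)) (cong r (π∘pos u)) (π-mono u≤x))
                                 (π-mono (<⇒≤ x<y))
                                 (subst (r (π y) ℚ.≤_) (cong r (π∘pos v)) (π-mono y≤v)))
                    (adj⇒close uv))

  adjacent⇒positions-close : ∀ {K} → (∀ {xs} → AllPairs (Adj G) xs → length xs ≤ K) →
                             ∀ {u v} → toℕ (pos u) < toℕ (pos v) → Adj G u v →
                             toℕ (pos v) < toℕ (pos u) + K
  adjacent⇒positions-close {K} clique≤K {u} {v} pu<pv uv = begin-strict
    b           ≡⟨ ≡.sym a+d≡b ⟩
    a + d       <⟨ +-monoʳ-< a (subst (_≤ K) (length-tabulate (π ∘ at)) (clique≤K segment-clique)) ⟩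
    a + K       ∎
    where
    open ≤-Reasoning
    a b d : ℕ
    a = toℕ (pos u)
    b = toℕ (pos v)
    d = b ∸ a
    a+d≡b : a + d ≡ b
    a+d≡b = m+[n∸m]≡n (<⇒≤ pu<pv)
    a+t≤b : (t : Fin (suc d)) → a + toℕ t ≤ b
    a+t≤b t = subst (a + toℕ t ≤_) a+d≡b (+-monoʳ-≤ a (s≤s⁻¹ (toℕ<n t)))
    at : Fin (suc d) → Fin N
    at t = fromℕ< (≤-<-trans (a+t≤b t) (toℕ<n (pos v)))
    toℕ-at : ∀ t → toℕ (at t) ≡ a + toℕ t
    toℕ-at t = toℕ-fromℕ< _
    segment : List V
    segment = tabulate (π ∘ at)
    segment-clique : AllPairs (Adj G) segment
    segment-clique = AllPairs.tabulate⁺-< λ {s} {t} s<t →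
      between-adjacent⇒adj
        (subst (a ≤_) (≡.sym (toℕ-at s)) (m≤m+n a (toℕ s)))
        (subst₂ _<_ (≡.sym (toℕ-at s)) (≡.sym (toℕ-at t)) (+-monoʳ-< a s<t))
        (subst (_≤ b) (≡.sym (toℕ-at t)) (a+t≤b t))
        uv

  proper-if-proper-upwards : ∀ {k} {E : V → V → Set} (c : V → Fin k) →
    (∀ {u v} → E u v → E v u) → (∀ {v} → ¬ E v v) →
    (∀ {u v} → toℕ (pos u) < toℕ (pos v) → E u v → c u ≢ c v) →
    ∀ u v → E u v → c u ≢ c v
  proper-if-proper-upwards {E = E} c E-sym E-irrefl upwards u v uv with <-cmp (toℕ (pos u)) (toℕ (pos v))
  ... | tri< pu<pv _ _ = upwards pu<pv uv
  ... | tri> _ _ pv<pu = upwards pv<pu (E-sym uv) ∘ ≡.sym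
  ... | tri≈ _ pu≡pv _ = ⊥-elim (E-irrefl (subst (E u) v≡u uv))
    where
    v≡u : v ≡ u
    v≡u = trans (≡.sym (π∘pos v)) (trans (cong π (toℕ-injective (≡.sym pu≡pv))) (π∘pos u))

  colouring-by-residues : ∀ K .{{_ : NonZero K}} →
    (∀ {u v} → toℕ (pos u) < toℕ (pos v) → Adj G u v → toℕ (pos v) < toℕ (pos u) + K) →
    Colorable G K
  colouring-by-residues K close = colour , proper-if-proper-upwards colour (Graph.sym G) (irrefl G) upwards
    where
    colour : V → Fin K
    colour v = toℕ (pos v) mod K
    upwards : ∀ {u v} → toℕ (pos u) < toℕ (pos v) → Adj G u v → colour u ≢ colour v
    upwards pu<pv uv same = <⇒≱ (close pu<pv uv) (mod≡∧<⇒+≤ K same pu<pv)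

  colouring-from-removed : ∀ f {m} → Colorable (removed G f) m → Colorable G (3 * m)
  colouring-from-removed f {zero} (c , _) = c , λ u → ⊥-elim (¬Fin0 (c u))
  colouring-from-removed f {suc _} c =
    colouring-by-residues _ (adjacent⇒positions-close (clique-length≤3*colours-removed G f c))

  select-if-adjacent : V → V → Maybe V
  select-if-adjacent v w with adj? v w
  ... | yes _ = just w
  ... | no _  = nothing

  select-if-adjacent-adj : ∀ v w {w′} → select-if-adjacent v w ≡ just w′ → Adj G v w′
  select-if-adjacent-adj v w eq with adj? v w
  select-if-adjacent-adj v w refl | yes vw = vw

  select-if-adjacent-hit : ∀ {v w} → Adj G v w → select-if-adjacent v w ≡ just w
  select-if-adjacent-hit {v} {w} vw with adj? v w
  ... | yes _  = refl
  ... | no ¬vw = ⊥-elim (¬vw vw)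

  select-partner : V → Maybe V
  select-partner v with partner (toℕ (pos v)) <? N
  ... | yes p<N = select-if-adjacent v (π (fromℕ< p<N))
  ... | no _    = nothing

  select-partner-adj : ∀ v {w} → select-partner v ≡ just w → Adj G v w
  select-partner-adj v eq with partner (toℕ (pos v)) <? N
  ... | yes p<N = select-if-adjacent-adj v _ eq

  select-partner-hit : ∀ {u v} → partner (toℕ (pos u)) ≡ toℕ (pos v) → Adj G u v →
                       select-partner u ≡ just v
  select-partner-hit {u} {v} p≡pv uv with partner (toℕ (pos u)) <? N
  ... | yes p<N = trans (cong (select-if-adjacent u) π[p]≡v) (select-if-adjacent-hit uv)
    where
    π[p]≡v : π (fromℕ< p<N) ≡ v
    π[p]≡v = trans (cong π (toℕ-injective (trans (toℕ-fromℕ< p<N) p≡pv))) (π∘pos v)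
  ... | no p≮N = ⊥-elim (p≮N (subst (_< N) (≡.sym p≡pv) (toℕ<n (pos v))))

  block-selection : OneSelection G
  block-selection = select-partner , λ v w → select-partner-adj v

  colouring-by-blocks : ∀ {k} → Colorable G k → Colorable (removed G block-selection) (2 + k / 3)
  colouring-by-blocks {k} c = colour , proper-if-proper-upwards colour (Graph.sym G∖f) (irrefl G∖f) upwards
    where
    G∖f : Graph
    G∖f = removed G block-selection
    colour : V → Fin (2 + k / 3)
    colour v = toℕ (pos v) / 3 mod (2 + k / 3)
    upwards : ∀ {u v} → toℕ (pos u) < toℕ (pos v) → Adj G∖f u v → colour u ≢ colour v
    upwards {u} {v} pu<pv (uv , ¬u→v , ¬v→u) same with <-cmp (toℕ (pos u) / 3) (toℕ (pos v) / 3)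
    ... | tri< lower _ _ = <⇒≱ (adjacent⇒positions-close (clique-length≤colours G c) pu<pv uv)
          (<⇒≤ (blocks-apart⇒far _ _ k (mod≡∧<⇒+≤ (2 + k / 3) same lower)))
    ... | tri> _ _ higher = <⇒≱ higher (/-monoˡ-≤ 3 (<⇒≤ pu<pv))
    ... | tri≈ _ same-block _ with same-block⇒partners pu<pv same-block
    ...   | inj₁ u→v = ¬u→v (select-partner-hit u→v uv)
    ...   | inj₂ v→u = ¬v→u (select-partner-hit v→u (Graph.sym G uv))

theorem1p3 : ∃ λ (c : ℕ) → ∀ (G : Graph) → IsUnitInterval G → ∀ (k k₁ : ℕ) →
    IsChromaticNumber G k → IsRobustChromaticNumber G k₁ →
    (k ≤ 3 * k₁) × (3 * k₁ ≤ k + 3 * c)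
theorem1p3 = 2 , λ G unit-interval k k₁ (χ-colouring , χ-minimal) ((f , χ₁-colouring) , χ₁-minimal) →
  let open UnitIntervalOrder G unit-interval
      open ≤-Reasoning
  in χ-minimal (3 * k₁) (colouring-from-removed f χ₁-colouring) ,
     (begin
       3 * k₁          ≤⟨ *-monoʳ-≤ 3 (χ₁-minimal block-selection _ (colouring-by-blocks χ-colouring)) ⟩
       3 * (2 + k / 3) ≤⟨ 3*[2+m/3]≤m+3*2 k ⟩
       k + 3 * 2       ∎)
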